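{- Let $B>1$ be an integer and let $(a_1,\ldots,a_m)$ be a sequence of positive integers that is bounded in average by $B$. Then $K(a_1,\ldots,a_m) \leq K(\underbrace{B,\ldots,B}_{m})$.
   Context: A sequence $(a_1,\ldots,a_m)$ of positive integers is bounded in average by $B$ if $\sum_{i=1}^t a_i \leq Bt$ for every $t$ with $1\le t\le m$. The continuant is defined by $K(a_1,\ldots,a_m)=q_m$ where $q_{ -1}=0$, $q_0=1$ and $q_j=a_jq_{j-1}+q_{j-2}$ for $j\ge1$; it is the denominator of $[0;a_1,\ldots,a_m]$. -}

module Defs where

open import Data.Nat using (ℕ; zero; suc; _+_; _*_; _≤_)
open import Data.List using (List; []; _∷_; take; length; replicate)
open import Data.Nat.ListAction using (sum)
open import Data.List.Relation.Unary.All using (All)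
open import Data.Product using (_×_; _,_; proj₂)

contStep : ℕ × ℕ → List ℕ → ℕ × ℕ
contStep p []                 = p
contStep (qprev , q) (a ∷ as) = contStep (q , a * q + qprev) as

-- K(a_1,...,a_m) = q_m, with q_{-1} = 0, q_0 = 1, q_j = a_j q_{j-1} + q_{j-2}.
K : List ℕ → ℕ
K as = proj₂ (contStep (0 , 1) as)

Positive : List ℕ → Set
Positive as = All (λ a → 1 ≤ a) as

BoundedInAverage : ℕ → List ℕ → Set
BoundedInAverage B as = (t : ℕ) → 1 ≤ t → t ≤ length as → sum (take t as) ≤ B * t

-- A partial quotient a acts on the state (q_{j-1} , q_j) by (p , q) ↦ (q , a q + p),
-- so the continuant is linear and monotone in the state. If some entry exceeds B,
-- then, the sequence being bounded in average, the first such entry y + 1 is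
-- preceded by a block x, B, …, B with x < B. Replacing x, B^k, y + 1 by
-- x + 1, B^k, y keeps the sequence positive and bounded in average and lowers the
-- excess ∑ (a_i ∸ B). It does not decrease the continuant: by linearity the unit
-- added to x contributes the run of B^k, y from (0 , q), and since x + 1 ≤ B this
-- dominates the unit taken from y + 1. Once the excess is zero, the sequence lies
-- pointwise below (B, …, B).
module Submission where

open import Defs
open import Data.Nat using (ℕ; _<_; _≤_)
open import Data.List using (List; length; replicate)

open import Data.Nat using (zero; suc; _+_; _*_; _∸_; z≤n; s≤s; s≤s⁻¹)
open import Data.Nat.Properties
open import Data.Nat.ListAction using (sum)
open import Data.Nat.ListAction.Properties using (sum-++)
open import Data.Nat.Solver using (module +-*-Solver)
open import Data.List using ([]; _∷_; _++_; take; map)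
open import Data.List.Properties using (++-assoc; map-++; length-++)
open import Data.List.Relation.Unary.All using (All; []; _∷_)
open import Data.List.Relation.Unary.All.Properties using (++⁺; ++⁻; ++⁻ˡ; ++⁻ʳ; replicate⁺)
open import Data.List.Relation.Unary.First using (First; first) renaming (_++_∷_ to _++ᶠ_∷_)
open import Data.List.Relation.Unary.First.Properties using (toView)
open import Data.List.Relation.Binary.Pointwise as Pointwise using (Pointwise; []; _∷_)
open import Data.Product using (_×_; _,_; proj₁; proj₂)
open import Data.Product.Relation.Binary.Pointwise.NonDependent as × using ()
open import Data.Sum using (inj₁; inj₂)
open import Data.Unit using (⊤; tt)
open import Data.Empty using (⊥-elim)
open import Relation.Nullary using (yes; no)
open import Relation.Binary.PropositionalEquality
open +-*-Solver

step : ℕ → ℕ × ℕ → ℕ × ℕ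
step a (p , q) = (q , a * q + p)

infixl 6 _⊕_
_⊕_ : ℕ × ℕ → ℕ × ℕ → ℕ × ℕ
(p , q) ⊕ (p′ , q′) = (p + p′ , q + q′)

infix 4 _≤²_
_≤²_ : ℕ × ℕ → ℕ × ℕ → Set
_≤²_ = ×.Pointwise _≤_ _≤_

Ordered : ℕ × ℕ → Set
Ordered (p , q) = p ≤ q

contStep-++ : ∀ s L M → contStep s (L ++ M) ≡ contStep (contStep s L) M
contStep-++ s []      M = refl
contStep-++ s (a ∷ L) M = contStep-++ (step a s) L M

step-⊕ : ∀ a s t → step a (s ⊕ t) ≡ step a s ⊕ step a t
step-⊕ a (p , q) (p′ , q′) = cong (q + q′ ,_)
  (solve 5 (λ a p q p′ q′ → a :* (q :+ q′) :+ (p :+ p′) := (a :* q :+ p) :+ (a :* q′ :+ p′))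
     refl a p q p′ q′)

contStep-⊕ : ∀ s t L → contStep (s ⊕ t) L ≡ contStep s L ⊕ contStep t L
contStep-⊕ s t []      = refl
contStep-⊕ s t (a ∷ L) =
  trans (cong (λ u → contStep u L) (step-⊕ a s t)) (contStep-⊕ (step a s) (step a t) L)

step-suc : ∀ a s → step (suc a) s ≡ step a s ⊕ (0 , proj₂ s)
step-suc a (p , q) = cong₂ _,_ (sym (+-identityʳ q))
  (solve 3 (λ a p q → (con 1 :+ a) :* q :+ p := (a :* q :+ p) :+ q) refl a p q)

contStep-step-replicate : ∀ a s k →
  contStep (step a s) (replicate k a) ≡ step a (contStep s (replicate k a))
contStep-step-replicate a s zero    = refl
contStep-step-replicate a s (suc k) = contStep-step-replicate a (step a s) k

⊕-mono-≤² : ∀ {s s′ t t′} → s ≤² s′ → t ≤² t′ → s ⊕ t ≤² s′ ⊕ t′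
⊕-mono-≤² (p≤ , q≤) (p′≤ , q′≤) = +-mono-≤ p≤ p′≤ , +-mono-≤ q≤ q′≤

step-mono-≤² : ∀ {a a′ s s′} → a ≤ a′ → s ≤² s′ → step a s ≤² step a′ s′
step-mono-≤² a≤ (p≤ , q≤) = q≤ , +-mono-≤ (*-mono-≤ a≤ q≤) p≤

contStep-mono-≤² : ∀ {s s′ L L′} → s ≤² s′ → Pointwise _≤_ L L′ → contStep s L ≤² contStep s′ L′
contStep-mono-≤² s≤ []         = s≤
contStep-mono-≤² s≤ (a≤ ∷ L≤) = contStep-mono-≤² (step-mono-≤² a≤ s≤) L≤

contStep-monoˡ-≤² : ∀ {s s′} L → s ≤² s′ → contStep s L ≤² contStep s′ L
contStep-monoˡ-≤² L s≤ = contStep-mono-≤² {L = L} s≤ (Pointwise.refl ≤-refl)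

step-ordered : ∀ {a} s → 1 ≤ a → Ordered (step a s)
step-ordered {suc a} (p , q) _ = ≤-trans (m≤m+n q (a * q)) (m≤m+n (suc a * q) p)

contStep-ordered : ∀ {s L} → Positive L → Ordered s → Ordered (contStep s L)
contStep-ordered []         s-ord = s-ord
contStep-ordered (1≤a ∷ ps) _     = contStep-ordered ps (step-ordered _ 1≤a)

module _ (B : ℕ) where

  step-transfer : ∀ {x y} k s → Ordered s → x < B → B ≤ y →
    step (suc y) (contStep (step x s) (replicate k B))
      ≤² step y (contStep (step (suc x) s) (replicate k B))
  step-transfer {x} {y} k s@(p , q) p≤q x<B B≤y =
    subst₂ _≤²_ (sym (step-suc y T)) (sym split) (⊕-mono-≤² (≤-refl , ≤-refl) (z≤n , lost≤gained))
    where
    Bᵏ : List ℕ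
    Bᵏ = replicate k B

    T D : ℕ × ℕ
    T = contStep (step x s) Bᵏ
    D = contStep (0 , q) Bᵏ

    xq+p≤Bq : x * q + p ≤ B * q + 0
    xq+p≤Bq = begin
      x * q + p  ≤⟨ +-monoʳ-≤ (x * q) p≤q ⟩
      x * q + q  ≡⟨ +-comm (x * q) q ⟩
      suc x * q  ≤⟨ *-monoˡ-≤ q x<B ⟩
      B * q      ≡⟨ +-identityʳ (B * q) ⟨
      B * q + 0  ∎
      where open ≤-Reasoning

    T≤BD : T ≤² step B D
    T≤BD = subst (T ≤²_) (contStep-step-replicate B (0 , q) k)
      (contStep-monoˡ-≤² Bᵏ (≤-refl , xq+p≤Bq))

    lost≤gained : proj₂ T ≤ y * proj₂ D + proj₁ D
    lost≤gained = ≤-trans (proj₂ T≤BD) (+-monoˡ-≤ (proj₁ D) (*-monoˡ-≤ (proj₂ D) B≤y))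

    split : step y (contStep (step (suc x) s) Bᵏ) ≡ step y T ⊕ step y D
    split = begin
      step y (contStep (step (suc x) s) Bᵏ)      ≡⟨ cong (λ u → step y (contStep u Bᵏ)) (step-suc x s) ⟩
      step y (contStep (step x s ⊕ (0 , q)) Bᵏ)  ≡⟨ cong (step y) (contStep-⊕ (step x s) (0 , q) Bᵏ) ⟩
      step y (T ⊕ D)                             ≡⟨ step-⊕ y T D ⟩
      step y T ⊕ step y D                        ∎
      where open ≡-Reasoning

  K-transfer : ∀ {x y} L k R → x < B → B ≤ y → Positive L →
    K (L ++ x ∷ replicate k B ++ suc y ∷ R) ≤ K (L ++ suc x ∷ replicate k B ++ y ∷ R)
  K-transfer {x} {y} L k R x<B B≤y posL =
    subst₂ _≤_ (cong proj₂ (sym (unfold x (suc y)))) (cong proj₂ (sym (unfold (suc x) y)))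
      (proj₂ (contStep-monoˡ-≤² R (step-transfer k s (contStep-ordered posL z≤n) x<B B≤y)))
    where
    s : ℕ × ℕ
    s = contStep (0 , 1) L
    unfold : ∀ a b → contStep (0 , 1) (L ++ a ∷ replicate k B ++ b ∷ R)
                       ≡ contStep (step b (contStep (step a s) (replicate k B))) R
    unfold a b = trans (contStep-++ (0 , 1) L _) (contStep-++ (step a s) (replicate k B) (b ∷ R))

  Positive-transfer : ∀ {x y} L k R → 1 ≤ B → B ≤ y →
    Positive (L ++ x ∷ replicate k B ++ suc y ∷ R) → Positive (L ++ suc x ∷ replicate k B ++ y ∷ R)
  Positive-transfer L k R 1≤B B≤y pos with ++⁻ L pos
  ... | posL , _ ∷ posN with ++⁻ʳ (replicate k B) posN
  ... | _ ∷ posR = ++⁺ posL (s≤s z≤n ∷ ++⁺ (replicate⁺ k 1≤B) (≤-trans 1≤B B≤y ∷ posR))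

  length-transfer : ∀ {x x′ y y′} L k R →
    length (L ++ x ∷ replicate k B ++ y ∷ R) ≡ length (L ++ x′ ∷ replicate k B ++ y′ ∷ R)
  length-transfer []      k R = cong suc (trans (length-++ (replicate k B)) (sym (length-++ (replicate k B))))
  length-transfer (_ ∷ L) k R = cong suc (length-transfer L k R)

  excess : List ℕ → ℕ
  excess as = sum (map (_∸ B) as)

  excess-++ : ∀ L M → excess (L ++ M) ≡ excess L + excess M
  excess-++ L M = trans (cong sum (map-++ (_∸ B) L M)) (sum-++ (map (_∸ B) L) (map (_∸ B) M))

  excess-replicate-++ : ∀ k M → excess (replicate k B ++ M) ≡ excess M
  excess-replicate-++ zero    M = refl
  excess-replicate-++ (suc k) M = cong₂ _+_ (n∸n≡0 B) (excess-replicate-++ k M)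

  excess-transfer : ∀ {x y} L k R → x < B → B ≤ y →
    excess (L ++ suc x ∷ replicate k B ++ y ∷ R) < excess (L ++ x ∷ replicate k B ++ suc y ∷ R)
  excess-transfer {x} {y} L k R x<B B≤y
    rewrite excess-++ L (suc x ∷ replicate k B ++ y ∷ R) | excess-++ L (x ∷ replicate k B ++ suc y ∷ R)
          | m≤n⇒m∸n≡0 x<B | m≤n⇒m∸n≡0 (<⇒≤ x<B)
          | excess-replicate-++ k (y ∷ R) | excess-replicate-++ k (suc y ∷ R)
          | +-∸-assoc 1 B≤y
          = +-monoʳ-< (excess L) ≤-refl

  -- Bounded c as: every prefix of as of length t sums to at most B t + c.
  Bounded : ℕ → List ℕ → Set
  Bounded c []       = ⊤
  Bounded c (a ∷ as) = a ≤ B + c × Bounded (B + c ∸ a) as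

  prefixSums⇒Bounded : ∀ c as → (∀ t → 1 ≤ t → t ≤ length as → sum (take t as) ≤ B * t + c) → Bounded c as
  prefixSums⇒Bounded c []       _ = tt
  prefixSums⇒Bounded c (a ∷ as) h = a≤B+c , prefixSums⇒Bounded (B + c ∸ a) as h′
    where
    a≤B+c : a ≤ B + c
    a≤B+c = subst₂ _≤_ (+-identityʳ a) (cong (_+ c) (*-identityʳ B)) (h 1 ≤-refl (s≤s z≤n))

    h′ : ∀ t → 1 ≤ t → t ≤ length as → sum (take t as) ≤ B * t + (B + c ∸ a)
    h′ t _ t≤n = +-cancelˡ-≤ a _ _ (begin
      a + sum (take t as)           ≤⟨ h (suc t) (s≤s z≤n) (s≤s t≤n) ⟩
      B * suc t + c                 ≡⟨ cong (_+ c) (*-suc B t) ⟩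
      B + B * t + c                 ≡⟨ solve 3 (λ b bt c → b :+ bt :+ c := bt :+ (b :+ c)) refl B (B * t) c ⟩
      B * t + (B + c)               ≡⟨ cong (B * t +_) (m+[n∸m]≡n a≤B+c) ⟨
      B * t + (a + (B + c ∸ a))     ≡⟨ solve 3 (λ bt a d → bt :+ (a :+ d) := a :+ (bt :+ d)) refl (B * t) a (B + c ∸ a) ⟩
      a + (B * t + (B + c ∸ a))     ∎)
      where open ≤-Reasoning

  Bounded-replicate-++⁻ : ∀ {c M} k → Bounded c (replicate k B ++ M) → Bounded c M
  Bounded-replicate-++⁻       zero    h       = h
  Bounded-replicate-++⁻ {c} (suc k) (_ , h) =
    Bounded-replicate-++⁻ k (subst (λ d → Bounded d _) (m+n∸m≡n B c) h)

  Bounded-replicate-++⁺ : ∀ {c M} k → Bounded c M → Bounded c (replicate k B ++ M)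
  Bounded-replicate-++⁺       zero    h = h
  Bounded-replicate-++⁺ {c} (suc k) h =
    m≤m+n B c , subst (λ d → Bounded d _) (sym (m+n∸m≡n B c)) (Bounded-replicate-++⁺ k h)

  Bounded-transfer : ∀ {c x y} L k R → x < B →
    Bounded c (L ++ x ∷ replicate k B ++ suc y ∷ R) → Bounded c (L ++ suc x ∷ replicate k B ++ y ∷ R)
  Bounded-transfer (_ ∷ L) k R x<B (a≤ , h) = a≤ , Bounded-transfer L k R x<B h
  Bounded-transfer {c} {x} {y} [] k R x<B (_ , h) with Bounded-replicate-++⁻ k h
  ... | suc-y≤ , hR = x<B+c , Bounded-replicate-++⁺ k
          (s≤s⁻¹ (subst (suc y ≤_) room suc-y≤) , subst (λ n → Bounded (n ∸ suc y) R) room hR)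
    where
    x<B+c : suc x ≤ B + c
    x<B+c = ≤-trans x<B (m≤m+n B c)
    room : B + (B + c ∸ x) ≡ suc (B + (B + c ∸ suc x))
    room = trans (cong (B +_) (+-∸-assoc 1 x<B+c)) (+-suc B (B + c ∸ suc x))

  data LastBelowView : List ℕ → Set where
    constant   : ∀ k → LastBelowView (replicate k B)
    last-below : ∀ L {x} k → x < B → LastBelowView (L ++ x ∷ replicate k B)

  lastBelowView : ∀ {P} → All (_≤ B) P → LastBelowView P
  lastBelowView [] = constant 0
  lastBelowView {a ∷ _} (a≤B ∷ P≤B) with lastBelowView P≤B
  ... | last-below L k x<B = last-below (a ∷ L) k x<B
  ... | constant k with a ≟ B
  ...   | yes refl = constant (suc k)
  ...   | no a≢B   = last-below [] k (≤∧≢⇒< a≤B a≢B)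

  data Transferable : List ℕ → Set where
    transferable : ∀ L {x} k {y} R → x < B → B ≤ y → Transferable (L ++ x ∷ replicate k B ++ suc y ∷ R)

  -- The first entry above B cannot be preceded by B's only, since the
  -- prefix ending there would exceed the average bound.
  First⇒Transferable : ∀ {as} → Bounded 0 as → First (_≤ B) (B <_) as → Transferable as
  First⇒Transferable bd fst with toView fst
  ... | P≤B ++ᶠ s≤s B≤y ∷ R with lastBelowView P≤B
  ...   | constant k = ⊥-elim (<⇒≱ (s≤s B≤y) (subst (_ ≤_) (+-identityʳ B) (proj₁ (Bounded-replicate-++⁻ k bd))))
  ...   | last-below L {x} k x<B =
    subst Transferable (sym (++-assoc L (x ∷ replicate k B) _)) (transferable L k R x<B B≤y)

  All≤⇒K-≤-replicate : ∀ {as} → All (_≤ B) as → K as ≤ K (replicate (length as) B)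
  All≤⇒K-≤-replicate as≤B = proj₂ (contStep-mono-≤² (≤-refl , ≤-refl) (pointwise as≤B))
    where
    pointwise : ∀ {as} → All (_≤ B) as → Pointwise _≤_ as (replicate (length as) B)
    pointwise []          = []
    pointwise (a≤B ∷ as≤B) = a≤B ∷ pointwise as≤B

  Bounded⇒K-≤-replicate : 1 ≤ B → ∀ n as → excess as < n → Positive as → Bounded 0 as →
    K as ≤ K (replicate (length as) B)
  Bounded⇒K-≤-replicate 1≤B zero    as ()
  Bounded⇒K-≤-replicate 1≤B (suc n) as ex pos bd with first (λ a → ≤-<-connex a B) as
  ... | inj₂ as≤B = All≤⇒K-≤-replicate as≤B
  ... | inj₁ fst with First⇒Transferable bd fst
  ...   | transferable L {x} k {y} R x<B B≤y = begin
    K (L ++ x ∷ replicate k B ++ suc y ∷ R)         ≤⟨ K-transfer L k R x<B B≤y (++⁻ˡ L pos) ⟩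
    K (L ++ suc x ∷ replicate k B ++ y ∷ R)         ≤⟨ Bounded⇒K-≤-replicate 1≤B n _
                                                         (<-≤-trans (excess-transfer L k R x<B B≤y) (s≤s⁻¹ ex))
                                                         (Positive-transfer L k R 1≤B B≤y pos)
                                                         (Bounded-transfer L k R x<B bd) ⟩
    K (replicate (length (L ++ suc x ∷ replicate k B ++ y ∷ R)) B)
                                                    ≡⟨ cong (λ m → K (replicate m B)) (length-transfer L k R) ⟨
    K (replicate (length (L ++ x ∷ replicate k B ++ suc y ∷ R)) B) ∎
    where open ≤-Reasoning

lemma1 : (B : ℕ) → 1 < B → (as : List ℕ) → Positive as → BoundedInAverage B as →
    K as ≤ K (replicate (length as) B)
lemma1 B 1<B as pos bia =
  Bounded⇒K-≤-replicate B (<⇒≤ 1<B) (suc (excess B as)) as ≤-refl pos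
    (prefixSums⇒Bounded B 0 as (λ t 1≤t t≤m → ≤-trans (bia t 1≤t t≤m) (m≤m+n (B * t) 0)))
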